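{- Let $G$ be a finite graph with vertices identified with $\{1,\dots,|V(G)|\}$, let $n, r$ be positive integers, and let $\mathcal F_G$ be a collection of pairs $(v,S)$ with $v\in V(G)$ and $S$ a set of neighbours of $v$, such that for any $v \in V(G)$ and any neighbours $u_1, \ldots, u_r$ of $v$ there is some $(v,S) \in \mathcal F_G$ with $u_1, \ldots, u_r \in S$. Suppose a $(G,n,\mathcal F_{G})$-independent system exists. Then there is an integer $n'\le 2^{n-1}$, a partition of $V(G)$ into sets $T_1, \ldots, T_{n'}, T_{n'+1}$, and for each $1\le i\le n'$ a collection $\mathcal F_{G[T_i]}$ of pairs $(v,S)$ with $v\in T_i$ and $S$ a set of neighbours of $v$ in $G[T_i]$, such that: (1) $T_{n'+1}$ is an independent set in $G$; (2) for $1 \leq i \leq n'$, there is a $(G[T_i],\lfloor n/2 \rfloor, \mathcal F_{G[T_i]})$-independent system (with respect to the ordering of $T_i$ inherited from $G$); (3) for each $1 \leq i \leq n'$, any $v \in T_i$ and any neighbours $u_1, \ldots, u_{r-1}$ of $v$ in $G[T_i]$, there is some $(v,S) \in \mathcal F_{G[T_i]}$ with $u_1, \ldots, u_{r-1} \in S$.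
   Context: $G[T]$ denotes the subgraph induced by $T$. For a graph $G$ whose vertices are identified with (or ordered as) a set of integers, a nonnegative integer $n$, and a collection $\mathcal F$ of pairs $(v,S)$ with $v\in V(G)$ and $S$ a set of neighbours of $v$, a family $\{A_{u,v}\}$ indexed by edges $(u,v)\in E(G)$ with $u<v$, each $A_{u,v}\subseteq[n]=\{1,\dots,n\}$, is $(G,n,\mathcal F)$-independent if for every $(v,S)\in\mathcal F$: if $v>\min S$ then $\bigcap_{u\in S,\,u<v}A_{u,v}\setminus\bigcup_{w\in S,\,w>v}A_{v,w}\neq\emptyset$, and if $v<\min S$ (or $S=\emptyset$) then $[n]\setminus\bigcup_{w\in S,\,w>v}A_{v,w}\neq\emptyset$. -}

module Defs where

open import Data.Nat using (ℕ)
open import Data.Bool using (Bool; true; false; T)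
open import Data.Fin using (Fin; _<_)
open import Data.Fin.Subset using (Subset; _∈_; _∉_)
open import Data.Product using (_×_; _,_; ∃; Σ)
open import Data.List using (List)
open import Data.Unit using (⊤)
import Data.List.Membership.Propositional as LM
open import Relation.Nullary using (¬_)
open import Relation.Binary.PropositionalEquality using (_≡_)

-- A finite simple graph on vertex set Fin N (vertex i ~ integer i+1; the
-- order of vertices is the usual order on Fin N).
record Graph (N : ℕ) : Set where
  field
    adj    : Fin N → Fin N → Bool
    sym    : ∀ u v → adj u v ≡ adj v u
    irrefl : ∀ v → adj v v ≡ false

Edge : ∀ {N} → Graph N → Fin N → Fin N → Set
Edge G u v = T (Graph.adj G u v)

Family : ℕ → Set
Family N = List (Fin N × Subset N)

_∈F_ : ∀ {N} → Fin N × Subset N → Family N → Set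
p ∈F F = LM._∈_ p F

-- A vertex set T ⊆ V(G); G[T] is the induced subgraph, with the order
-- inherited from G.
VSet : ℕ → Set₁
VSet N = Fin N → Set

AllV : ∀ {N} → VSet N
AllV _ = ⊤

WellFormed : ∀ {N} → Graph N → VSet N → Family N → Set
WellFormed G Tv F = ∀ v S → (v , S) ∈F F → Tv v × (∀ u → u ∈ S → Edge G v u × Tv u)

-- The family A (A u v ⊆ [n] = Fin n, only used for edges u < v of G[T])
-- is (G[T], n, F)-independent.
IndepSystem : ∀ {N} → Graph N → VSet N → (n : ℕ) → Family N
            → (Fin N → Fin N → Subset n) → Set
IndepSystem G Tv n F A = ∀ v S → (v , S) ∈F F →
    (  (∃ λ u → u ∈ S × u < v)
         → ∃ λ (x : Fin n) → (∀ u → u ∈ S → u < v → x ∈ A u v)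
                            × (∀ w → w ∈ S → v < w → x ∉ A v w))
  × (¬ (∃ λ u → u ∈ S × u < v)
         → ∃ λ (x : Fin n) → (∀ w → w ∈ S → v < w → x ∉ A v w))

HasIndepSystem : ∀ {N} → Graph N → VSet N → ℕ → Family N → Set
HasIndepSystem {N} G Tv n F = ∃ λ (A : Fin N → Fin N → Subset n) → IndepSystem G Tv n F A

Covers : ∀ {N} → Graph N → VSet N → Family N → ℕ → Set
Covers {N} G Tv F k = ∀ v → Tv v → (us : Fin k → Fin N)
  → (∀ j → Edge G v (us j) × Tv (us j))
  → ∃ λ S → ((v , S) ∈F F) × (∀ j → us j ∈ S)

IndependentSet : ∀ {N} → Graph N → VSet N → Set
IndependentSet G Tv = ∀ u v → Tv u → Tv v → ¬ Edge G u v

-- Orient the system along each edge: for an edge v p let D v p be A p v if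
-- p < v and ∁ (A v p) if v < p. The witness of any (v , S) ∈ F then lies in
-- D v p for every p ∈ S, and the two ends of an edge carry complementary sets.
-- Call D ⊆ [n] small if 2|D| < n, or 2|D| = n and 0 ∉ D; exactly one of D and
-- ∁ D is small, so there are at most 2^(n-1) small sets. Put v into the class
-- of the small set D v p for some neighbour p, and into the last part if there
-- is none: an edge inside the last part would give its ends complementary sets
-- that are both not small. Inside the class of C, keep each (v , S) with such a
-- p ∈ S, restricted to the class, and compress every A u v ∩ C into [n/2] by
-- the position of its elements in C (|C| ≤ n/2). The old witness lies in
-- D v p = C, so its position is a new witness; the requirement that p ∈ S uses
-- up one of the r covered neighbours.

module Submission where

open import Defs

open import Data.Nat using (ℕ; zero; suc; _≤_; _<_; _^_; _/_; _+_; _*_; _∸_; z≤n; s≤s)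
import Data.Nat.Properties as ℕ
open import Data.Nat.DivMod using (m*n/n≡m; /-monoˡ-≤)
open import Data.Bool as Bool using (true; false; not; T)
open import Data.Bool.Properties using (not-involutive; T?)
open import Data.Fin as Fin using (Fin; zero; suc; fromℕ; inject₁; combine; quotient; remainder; remQuot)
open import Data.Fin.Properties as Fin using (2↔Bool; remQuot-combine; any?)
open import Data.Fin.Subset using (Subset; _∈_; _∉_; ∁; ∣_∣; ⊥; _∩_)
open import Data.Fin.Subset.Properties
  using (∣∁p∣≡n∸∣p∣; ∣p∣≤n; _∈?_; x∈p⇒x∉∁p; x∉∁p⇒x∈p; x∉p⇒x∈∁p; x∈p∩q⁺; x∈p∩q⁻)
open import Data.Vec using ([]; _∷_; lookup; map; tabulate; here; there)
open import Data.Vec.Properties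
  using (map-∘; map-cong; map-id; []=⇒lookup; lookup⇒[]=; lookup∘tabulate; ≡-dec)
open import Data.Vec.Functional using () renaming (_∷_ to _◂_)
import Data.List as List
open import Data.List.Membership.Propositional.Properties using (∈-map⁺; ∈-map⁻; ∈-filter⁺; ∈-filter⁻)
open import Data.Product using (_×_; _,_; proj₁; proj₂; ∃; Σ)
open import Data.Sum using (_⊎_; inj₁; inj₂)
open import Data.Unit using (tt)
open import Data.Empty using (⊥-elim)
open import Function.Base using (_∘_)
open import Function.Bundles using (Inverse)
open import Relation.Nullary using (¬_; Dec; yes; no; does)
open import Relation.Nullary.Decidable using (_⊎-dec_; _×-dec_; ¬?; dec-true)
open import Relation.Binary.Definitions using (tri<; tri≈; tri>)
open import Relation.Binary.PropositionalEquality

∁-involutive : ∀ {n} (p : Subset n) → ∁ (∁ p) ≡ p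
∁-involutive p = trans (sym (map-∘ not not p)) (trans (map-cong not-involutive p) (map-id p))

∣p∣+∣∁p∣≡n : ∀ {n} (p : Subset n) → ∣ p ∣ + ∣ ∁ p ∣ ≡ n
∣p∣+∣∁p∣≡n p = trans (cong (∣ p ∣ +_) (∣∁p∣≡n∸∣p∣ p)) (ℕ.m+[n∸m]≡n (∣p∣≤n p))

module _ where
  open Inverse 2↔Bool using (to; from; strictlyInverseˡ)

  toIndex : ∀ {m} → Subset m → Fin (2 ^ m)
  toIndex []      = zero
  toIndex (b ∷ p) = combine (from b) (toIndex p)

  fromIndex : ∀ {m} → Fin (2 ^ m) → Subset m
  fromIndex {zero}  _ = []
  fromIndex {suc m} i = to (quotient (2 ^ m) i) ∷ fromIndex (remainder {2} (2 ^ m) i)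

  fromIndex-toIndex : ∀ {m} (p : Subset m) → fromIndex (toIndex p) ≡ p
  fromIndex-toIndex []              = refl
  fromIndex-toIndex {suc m} (b ∷ p) = cong₂ _∷_
    (trans (cong (to ∘ proj₁) digits) (strictlyInverseˡ b))
    (trans (cong (fromIndex ∘ proj₂) digits) (fromIndex-toIndex p))
    where
    digits : remQuot {2} (2 ^ m) (combine (from b) (toIndex p)) ≡ (from b , toIndex p)
    digits = remQuot-combine {k = 2 ^ m} (from b) (toIndex p)

2∣∁p∣+2∣p∣≡n+n : ∀ {n} (p : Subset n) → 2 * ∣ ∁ p ∣ + 2 * ∣ p ∣ ≡ n + n
2∣∁p∣+2∣p∣≡n+n {n} p = begin
  2 * ∣ ∁ p ∣ + 2 * ∣ p ∣ ≡⟨ sym (ℕ.*-distribˡ-+ 2 ∣ ∁ p ∣ ∣ p ∣) ⟩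
  2 * (∣ ∁ p ∣ + ∣ p ∣)   ≡⟨ cong (2 *_) (trans (ℕ.+-comm ∣ ∁ p ∣ ∣ p ∣) (∣p∣+∣∁p∣≡n p)) ⟩
  2 * n                   ≡⟨ cong (n +_) (ℕ.+-identityʳ n) ⟩
  n + n                   ∎
  where open ≡-Reasoning

n<2∣p∣⇒2∣∁p∣<n : ∀ {n} (p : Subset n) → n < 2 * ∣ p ∣ → 2 * ∣ ∁ p ∣ < n
n<2∣p∣⇒2∣∁p∣<n {n} p n<2c = ℕ.+-cancelʳ-< n (2 * ∣ ∁ p ∣) n
  (subst (2 * ∣ ∁ p ∣ + n <_) (2∣∁p∣+2∣p∣≡n+n p) (ℕ.+-monoʳ-< (2 * ∣ ∁ p ∣) n<2c))

2∣p∣≡n⇒2∣∁p∣≡n : ∀ {n} (p : Subset n) → 2 * ∣ p ∣ ≡ n → 2 * ∣ ∁ p ∣ ≡ n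
2∣p∣≡n⇒2∣∁p∣≡n {n} p 2c≡n = ℕ.+-cancelʳ-≡ n (2 * ∣ ∁ p ∣) n
  (trans (cong (2 * ∣ ∁ p ∣ +_) (sym 2c≡n)) (2∣∁p∣+2∣p∣≡n+n p))

2∣p∣<n⇒2∣∁p∣≮n : ∀ {n} (p : Subset n) → 2 * ∣ p ∣ < n → ¬ 2 * ∣ ∁ p ∣ < n
2∣p∣<n⇒2∣∁p∣≮n p 2c<n 2c'<n = ℕ.<-irrefl (2∣∁p∣+2∣p∣≡n+n p) (ℕ.+-mono-< 2c'<n 2c<n)

Small : ∀ {m} → Subset (suc m) → Set
Small {m} D = 2 * ∣ D ∣ < suc m ⊎ (2 * ∣ D ∣ ≡ suc m × zero ∉ D)

small? : ∀ {m} (D : Subset (suc m)) → Dec (Small D)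
small? {m} D = (2 * ∣ D ∣ ℕ.<? suc m) ⊎-dec ((2 * ∣ D ∣ ℕ.≟ suc m) ×-dec ¬? (zero ∈? D))

small⊎∁small : ∀ {m} (D : Subset (suc m)) → Small D ⊎ Small (∁ D)
small⊎∁small {m} D with ℕ.<-cmp (2 * ∣ D ∣) (suc m)
... | tri< 2c<n _ _ = inj₁ (inj₁ 2c<n)
... | tri> _ _ n<2c = inj₂ (inj₁ (n<2∣p∣⇒2∣∁p∣<n D n<2c))
... | tri≈ _ 2c≡n _ with zero ∈? D
...   | no 0∉D  = inj₁ (inj₂ (2c≡n , 0∉D))
...   | yes 0∈D = inj₂ (inj₂ (2∣p∣≡n⇒2∣∁p∣≡n D 2c≡n , x∈p⇒x∉∁p 0∈D))

small⇒¬∁small : ∀ {m} {D : Subset (suc m)} → Small D → ¬ Small (∁ D)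
small⇒¬∁small {D = D} (inj₁ 2c<n) (inj₁ 2c'<n) = 2∣p∣<n⇒2∣∁p∣≮n D 2c<n 2c'<n
small⇒¬∁small {D = D} (inj₁ 2c<n) (inj₂ (2c'≡n , _)) =
  ℕ.<⇒≢ 2c<n (subst (λ q → 2 * ∣ q ∣ ≡ _) (∁-involutive D) (2∣p∣≡n⇒2∣∁p∣≡n (∁ D) 2c'≡n))
small⇒¬∁small {D = D} (inj₂ (2c≡n , _)) (inj₁ 2c'<n) =
  ℕ.<⇒≢ 2c'<n (2∣p∣≡n⇒2∣∁p∣≡n D 2c≡n)
small⇒¬∁small (inj₂ (_ , 0∉D)) (inj₂ (_ , 0∉∁D)) = 0∉D (x∉∁p⇒x∈p 0∉∁D)

small⇒∣D∣≤half : ∀ {m} {D : Subset (suc m)} → Small D → ∣ D ∣ ≤ suc m / 2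
small⇒∣D∣≤half {m} {D} s = subst (_≤ suc m / 2) (m*n/n≡m ∣ D ∣ 2)
  (/-monoˡ-≤ 2 (subst (_≤ suc m) (ℕ.*-comm 2 ∣ D ∣) (twice≤ s)))
  where
  twice≤ : Small D → 2 * ∣ D ∣ ≤ suc m
  twice≤ (inj₁ 2c<n)       = ℕ.<⇒≤ 2c<n
  twice≤ (inj₂ (2c≡n , _)) = ℕ.≤-reflexive 2c≡n

-- The small set of each pair {D , ∁ D} is recovered from the tail of the one
-- not containing 0, so small subsets of Fin (suc m) are indexed by Subset m.
code : ∀ {m} → Subset (suc m) → Subset m
code (false ∷ E) = E
code (true  ∷ E) = ∁ E

decode : ∀ {m} → Subset m → Subset (suc m)
decode E with small? (false ∷ E)
... | yes _ = false ∷ E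
... | no  _ = true ∷ ∁ E

decode-small : ∀ {m} (E : Subset m) → Small (decode E)
decode-small E with small? (false ∷ E)
... | yes s  = s
... | no  ¬s with small⊎∁small (false ∷ E)
...   | inj₁ s  = ⊥-elim (¬s s)
...   | inj₂ s' = s'

decode-code : ∀ {m} {D : Subset (suc m)} → Small D → decode (code D) ≡ D
decode-code {D = false ∷ E} s with small? (false ∷ E)
... | yes _  = refl
... | no  ¬s = ⊥-elim (¬s s)
decode-code {D = true ∷ E} s with small? (false ∷ ∁ E)
... | yes s' = ⊥-elim (small⇒¬∁small s s')
... | no  _  = cong (true ∷_) (∁-involutive E)

index : ∀ {m} → Subset (suc m) → Fin (2 ^ m)
index D = toIndex (code D)

class : ∀ {m} → Fin (2 ^ m) → Subset (suc m)
class {m} i = decode (fromIndex {m} i)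

class-index : ∀ {m} {D : Subset (suc m)} → Small D → class (index D) ≡ D
class-index {D = D} s = trans (cong decode (fromIndex-toIndex (code D))) (decode-code s)

class-small : ∀ {m} (i : Fin (2 ^ m)) → Small (class i)
class-small {m} i = decode-small (fromIndex {m} i)

squeeze : ∀ {n k} (C : Subset n) → ∣ C ∣ ≤ k → Subset n → Subset k
squeeze []          _       []      = ⊥
squeeze (true  ∷ C) (s≤s h) (b ∷ X) = b ∷ squeeze C h X
squeeze (false ∷ C) h       (_ ∷ X) = squeeze C h X

position : ∀ {n k} {C : Subset n} {x} → x ∈ C → ∣ C ∣ ≤ k → Fin k
position {C = true  ∷ C} here        (s≤s h) = zero
position {C = true  ∷ C} (there x∈C) (s≤s h) = suc (position x∈C h)
position {C = false ∷ C} (there x∈C) h       = position x∈C h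

lookup-squeeze : ∀ {n k} {C : Subset n} {x} (x∈C : x ∈ C) (h : ∣ C ∣ ≤ k) (X : Subset n)
  → lookup (squeeze C h X) (position x∈C h) ≡ lookup X x
lookup-squeeze {C = true  ∷ C} here        (s≤s h) (b ∷ X) = refl
lookup-squeeze {C = true  ∷ C} (there x∈C) (s≤s h) (b ∷ X) = lookup-squeeze x∈C h X
lookup-squeeze {C = false ∷ C} (there x∈C) h       (b ∷ X) = lookup-squeeze x∈C h X

squeeze-∈ : ∀ {n k} {C : Subset n} {x} (x∈C : x ∈ C) (h : ∣ C ∣ ≤ k) {X : Subset n}
  → x ∈ X → position x∈C h ∈ squeeze C h X
squeeze-∈ x∈C h {X} x∈X = lookup⇒[]= _ _ (trans (lookup-squeeze x∈C h X) ([]=⇒lookup x∈X))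

squeeze-∉ : ∀ {n k} {C : Subset n} {x} (x∈C : x ∈ C) (h : ∣ C ∣ ≤ k) {X : Subset n}
  → x ∉ X → position x∈C h ∉ squeeze C h X
squeeze-∉ x∈C h {X} x∉X p∈ =
  x∉X (lookup⇒[]= _ _ (trans (sym (lookup-squeeze x∈C h X)) ([]=⇒lookup p∈)))

toSubset : ∀ {n} {P : Fin n → Set} → (∀ x → Dec (P x)) → Subset n
toSubset P? = tabulate (does ∘ P?)

∈-toSubset⁺ : ∀ {n} {P : Fin n → Set} (P? : ∀ x → Dec (P x)) {x} → P x → x ∈ toSubset P?
∈-toSubset⁺ P? {x} px =
  lookup⇒[]= x _ (trans (lookup∘tabulate (does ∘ P?) x) (dec-true (P? x) px))

∈-toSubset⁻ : ∀ {n} {P : Fin n → Set} (P? : ∀ x → Dec (P x)) {x} → x ∈ toSubset P? → P x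
∈-toSubset⁻ {P = P} P? {x} x∈ = witness (P? x) (trans (sym (lookup∘tabulate (does ∘ P?) x)) ([]=⇒lookup x∈))
  where
  witness : (d : Dec (P x)) → does d ≡ true → P x
  witness (yes px) _  = px
  witness (no  _)  ()

Edge-sym : ∀ {N} (G : Graph N) {u v} → Edge G u v → Edge G v u
Edge-sym G {u} {v} = subst T (Graph.sym G u v)

Edge⇒≢ : ∀ {N} (G : Graph N) {u v} → Edge G u v → u ≢ v
Edge⇒≢ G {u} e refl = subst T (Graph.irrefl G u) e

independence-witness : ∀ {N} {G : Graph N} {Tv n F A} → IndepSystem G Tv n F A
  → ∀ {v S} → (v , S) ∈F F
  → ∃ λ x → (∀ u → u ∈ S → u Fin.< v → x ∈ A u v) × (∀ w → w ∈ S → v Fin.< w → x ∉ A v w)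
independence-witness I {v} {S} vS with any? (λ u → (u ∈? S) ×-dec (u Fin.<? v))
... | yes below = let (x , x∈ , x∉) = proj₁ (I v S vS) below in x , x∈ , x∉
... | no ¬below = let (x , x∉) = proj₂ (I v S vS) ¬below
                  in x , (λ u u∈S u<v → ⊥-elim (¬below (u , u∈S , u<v))) , x∉

module Construction {N} (G : Graph N) (m : ℕ) (A : Fin N → Fin N → Subset (suc m)) (F : Family N) where

  D : Fin N → Fin N → Subset (suc m)
  D v p with p Fin.<? v
  ... | yes _ = A p v
  ... | no  _ = ∁ (A v p)

  D-swap : ∀ {u v} → u ≢ v → D v u ≡ ∁ (D u v)
  D-swap {u} {v} u≢v with u Fin.<? v | v Fin.<? u
  ... | yes _   | no  _   = sym (∁-involutive (A u v))
  ... | no  _   | yes _   = refl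
  ... | yes u<v | yes v<u = ⊥-elim (Fin.<-asym u<v v<u)
  ... | no  u≮v | no  v≮u = ⊥-elim (u≢v (Fin.≤-antisym (ℕ.≮⇒≥ v≮u) (ℕ.≮⇒≥ u≮v)))

  witness∈D : ∀ {v S x}
    → (∀ u → u ∈ S → u Fin.< v → x ∈ A u v) → (∀ w → w ∈ S → v Fin.< w → x ∉ A v w)
    → ∀ {p} → p ∈ S → p ≢ v → x ∈ D v p
  witness∈D {v} x∈ x∉ {p} p∈S p≢v with p Fin.<? v
  ... | yes p<v = x∈ p p∈S p<v
  ... | no  p≮v = x∉p⇒x∈∁p (x∉ p p∈S (Fin.≤∧≢⇒< (ℕ.≮⇒≥ p≮v) (p≢v ∘ sym)))

  Eligible : Fin N → Fin N → Set
  Eligible v p = Edge G v p × Small (D v p)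

  eligible? : ∀ v p → Dec (Eligible v p)
  eligible? v p = T? (Graph.adj G v p) ×-dec small? (D v p)

  part : Fin N → Fin (suc (2 ^ m))
  part v with any? (eligible? v)
  ... | yes (p , _) = inject₁ (index (D v p))
  ... | no  _       = fromℕ (2 ^ m)

  part≡inject₁ : ∀ {v i} → part v ≡ inject₁ i → ∃ λ p → Edge G v p × D v p ≡ class {m} i
  part≡inject₁ {v} eq with any? (eligible? v)
  ... | yes (p , e , s) = p , e , trans (sym (class-index s)) (cong class (Fin.inject₁-injective eq))
  ... | no  _           = ⊥-elim (Fin.fromℕ≢inject₁ eq)

  part≡fromℕ : ∀ {v} → part v ≡ fromℕ (2 ^ m) → ∀ {p} → Edge G v p → ¬ Small (D v p)
  part≡fromℕ {v} eq {p} e s with any? (eligible? v)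
  ... | yes _          = Fin.fromℕ≢inject₁ (sym eq)
  ... | no  ¬eligible = ¬eligible (p , e , s)

  part-fromℕ-independent : IndependentSet G (λ v → part v ≡ fromℕ (2 ^ m))
  part-fromℕ-independent u v u∈ v∈ e with small⊎∁small (D u v)
  ... | inj₁ s = part≡fromℕ u∈ e s
  ... | inj₂ s = part≡fromℕ v∈ (Edge-sym G e) (subst Small (sym (D-swap (Edge⇒≢ G e))) s)

  Part : Fin (2 ^ m) → VSet N
  Part i v = part v ≡ inject₁ i

  part? : ∀ i v → Dec (Part i v)
  part? i v = part v Fin.≟ inject₁ i

  members : Fin (2 ^ m) → Subset N
  members i = toSubset (part? i)

  Chosen : Fin (2 ^ m) → Fin N × Subset N → Set
  Chosen i (v , S) = Part i v × ∃ λ p → p ∈ S × Edge G v p × D v p ≡ class {m} i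

  chosen? : ∀ i vS → Dec (Chosen i vS)
  chosen? i (v , S) = part? i v ×-dec
    any? (λ p → (p ∈? S) ×-dec (T? (Graph.adj G v p) ×-dec ≡-dec Bool._≟_ (D v p) (class i)))

  restrict : Fin (2 ^ m) → Fin N × Subset N → Fin N × Subset N
  restrict i (v , S) = v , S ∩ members i

  family : Fin (2 ^ m) → Family N
  family i = List.map (restrict i) (List.filter (chosen? i) F)

  ∈-family⁻ : ∀ {i v S'} → (v , S') ∈F family i
    → ∃ λ S → (v , S) ∈F F × Chosen i (v , S) × S' ≡ S ∩ members i
  ∈-family⁻ {i} vS'∈ with ∈-map⁻ (restrict i) vS'∈
  ... | (v , S) , vS∈ , refl =
    let (vS∈F , chosen) = ∈-filter⁻ (chosen? i) vS∈ in S , vS∈F , chosen , refl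

  family-wellFormed : WellFormed G AllV F → ∀ i → WellFormed G (Part i) (family i)
  family-wellFormed wf i v S' vS'∈ with ∈-family⁻ vS'∈
  ... | S , vS∈ , (v∈ , _) , refl = v∈ , λ u u∈ →
    let (u∈S , u∈i) = x∈p∩q⁻ S (members i) u∈
    in proj₁ (proj₂ (wf v S vS∈) u u∈S) , ∈-toSubset⁻ (part? i) u∈i

  family-covers : ∀ r → Covers G AllV F (suc r) → ∀ i → Covers G (Part i) (family i) r
  family-covers r cov i v v∈ us us∈ with part≡inject₁ v∈
  ... | p , e , Dp≡ with cov v tt (p ◂ us) (λ { zero → e , tt ; (suc j) → proj₁ (us∈ j) , tt })
  ... | S , vS∈ , covered = S ∩ members i ,
    ∈-map⁺ (restrict i) (∈-filter⁺ (chosen? i) vS∈ (v∈ , p , covered zero , e , Dp≡)) ,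
    λ j → x∈p∩q⁺ (covered (suc j) , ∈-toSubset⁺ (part? i) (proj₂ (us∈ j)))

  ∣class∣≤half : ∀ i → ∣ class {m} i ∣ ≤ suc m / 2
  ∣class∣≤half i = small⇒∣D∣≤half (class-small {m} i)

  squeezed : Fin (2 ^ m) → Fin N → Fin N → Subset (suc m / 2)
  squeezed i u v = squeeze (class i) (∣class∣≤half i) (A u v)

  family-independent : IndepSystem G AllV (suc m) F A
    → ∀ i → IndepSystem G (Part i) (suc m / 2) (family i) (squeezed i)
  family-independent I i v S' vS'∈ with ∈-family⁻ vS'∈
  ... | S , vS∈ , (_ , p , p∈S , e , Dp≡) , refl
      with independence-witness {G = G} {AllV} {suc m} {F} {A} I vS∈
  ... | x , x∈ , x∉ = (λ _ → y , y∈ , y∉) , (λ _ → y , y∉)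
    where
    x∈class : x ∈ class i
    x∈class = subst (x ∈_) Dp≡ (witness∈D x∈ x∉ p∈S (Edge⇒≢ G e ∘ sym))

    y : Fin (suc m / 2)
    y = position x∈class (∣class∣≤half i)

    y∈ : ∀ u → u ∈ S ∩ members i → u Fin.< v → y ∈ squeezed i u v
    y∈ u u∈ u<v = squeeze-∈ x∈class (∣class∣≤half i) (x∈ u (proj₁ (x∈p∩q⁻ S (members i) u∈)) u<v)

    y∉ : ∀ w → w ∈ S ∩ members i → v Fin.< w → y ∉ squeezed i v w
    y∉ w w∈ v<w = squeeze-∉ x∈class (∣class∣≤half i) (x∉ w (proj₁ (x∈p∩q⁻ S (members i) w∈)) v<w)

lemma4p2 : ∀ {N} (G : Graph N) (n r : ℕ) → 1 ≤ n → 1 ≤ r → (F : Family N)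
    → WellFormed G AllV F → Covers G AllV F r → HasIndepSystem G AllV n F
    → ∃ λ n' → n' ≤ 2 ^ (n ∸ 1)
      × Σ (Fin N → Fin (suc n')) λ part
      → Σ (Fin n' → Family N) λ Fs
      → IndependentSet G (λ v → part v ≡ fromℕ n')
        × (∀ i → WellFormed G (λ v → part v ≡ inject₁ i) (Fs i)
               × HasIndepSystem G (λ v → part v ≡ inject₁ i) (n / 2) (Fs i)
               × Covers G (λ v → part v ≡ inject₁ i) (Fs i) (r ∸ 1))
lemma4p2 G (suc m) (suc r) (s≤s z≤n) (s≤s z≤n) F wf cov (A , I) =
  2 ^ m , ℕ.≤-refl , part , family , part-fromℕ-independent ,
  λ i → family-wellFormed wf i , (squeezed i , family-independent I i) , family-covers r cov i
  where open Construction G m A F
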